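{- Let $\gamma\in\mathbb{N}^r$, let $H\subset\mathbb{Z}^r$ be a subgroup, and let $N$ be a positive integer. Let $L\subset\gamma+(H\cap\mathbb{N}^r)$ be a subset such that for every $\tau\in H\cap\mathbb{N}^r$ and every $\beta\in L$ we have $\beta+N\tau\in L$. Then $L$ is a union of at most finitely many sets of the form $\delta+\left((N\cdot H)\cap\mathbb{N}^r\right)$ with $\delta\in\mathbb{N}^r$.
   Context: $\mathbb{N}$ denotes the nonnegative integers; $N\cdot H=\{Nh: h\in H\}$. -}

module Defs where

open import Data.Nat using (ℕ; _+_; _*_)
open import Data.Integer using (ℤ; +_) renaming (_+_ to _+ℤ_; _*_ to _*ℤ_; -_ to -ℤ_)
open import Data.Fin using (Fin)
open import Data.Product using (Σ; _×_)
open import Relation.Binary.PropositionalEquality using (_≡_)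

-- ℕ^r and ℤ^r as functions on Fin r; equality of vectors is taken pointwise.
ℕ^ : ℕ → Set
ℕ^ r = Fin r → ℕ

ℤ^ : ℕ → Set
ℤ^ r = Fin r → ℤ

ι : ∀ {r} → ℕ^ r → ℤ^ r
ι v i = + (v i)

record IsSubgroup {r : ℕ} (H : ℤ^ r → Set) : Set where
  field
    zero-mem : H (λ _ → + 0)
    add-mem  : ∀ {a b} → H a → H b → H (λ i → a i +ℤ b i)
    neg-mem  : ∀ {a} → H a → H (λ i → -ℤ (a i))
    -- H is a set of vectors: membership respects pointwise equality
    resp     : ∀ {a b} → (∀ i → a i ≡ b i) → H a → H b

_∈H∩ℕ_ : ∀ {r} → ℕ^ r → (ℤ^ r → Set) → Set
τ ∈H∩ℕ H = H (ι τ)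

InNH∩ℕ : ∀ {r} → ℕ → (ℤ^ r → Set) → ℕ^ r → Set
InNH∩ℕ {r} N H τ = Σ (ℤ^ r) λ h → H h × (∀ i → + (τ i) ≡ + N *ℤ h i)

_∈_+ˢ_ : ∀ {r} → ℕ^ r → ℕ^ r → (ℕ^ r → Set) → Set
_∈_+ˢ_ {r} x δ S = Σ (ℕ^ r) λ τ → S τ × (∀ i → x i ≡ δ i + τ i)

module Submission where

-- The differences β − γ for β ∈ L lie in H, and N·H has finite index in H: by
-- induction on r, H is generated modulo its first-coordinate kernel by one g
-- whose first coordinate divides that of every element, so the classes are
-- J·g + (0 ∷ ρ) with J < N and ρ a class of the kernel. Split L according to
-- the class of β − γ. By Dickson's lemma each part has finitely many minimal
-- elements δ, and any x of the part above δ satisfies x − δ ∈ N·H ∩ ℕ^r.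
-- Conversely N·H ∩ ℕ^r = N·(H ∩ ℕ^r) because N > 0, so L is closed under
-- adding it.

open import Defs
open import Axiom.ExcludedMiddle using (ExcludedMiddle)
open import Data.Empty using (⊥-elim)
open import Data.Fin using (zero; suc)
open import Data.List using (List; []; [_]; _++_; map; concatMap; upTo)
open import Data.List.Extrema.Nat using (max; v≤max⁺)
open import Data.List.Membership.Propositional using (find; lose)
open import Data.List.Membership.Propositional.Properties using (∈-upTo⁺)
open import Data.List.Relation.Unary.Any as Any using (Any; here)
open import Data.List.Relation.Unary.Any.Properties
  using (map⁺; map⁻; ++⁺ˡ; ++⁺ʳ; concatMap⁺; concatMap⁻)
open import Data.Nat using (ℕ; zero; suc; _<_; _≤_; _≤?_; _∸_; >-nonZero)
open import Data.Nat.Induction using (<-rec)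
open import Data.Nat.Properties using (≤-refl; ≤-reflexive; <-≤-trans; ≰⇒>)
open import Data.Product using (Σ; Σ-syntax; ∃; _×_; _,_; proj₁; proj₂)
import Data.Product as Σ
open import Data.Sum using (inj₂)
open import Data.Vec.Functional using (head; tail)
open import Function using (_∘_; id)
open import Function.Bundles using (_⇔_; mk⇔)
open import Level using (0ℓ)
open import Relation.Nullary using (¬_; yes; no)
open import Relation.Binary.PropositionalEquality using (_≡_; refl; sym; trans; cong)

_≤ᵛ_ : ∀ {r} → ℕ^ r → ℕ^ r → Set
x ≤ᵛ y = ∀ i → x i ≤ y i

≤ᵛ-cons : ∀ {r} {x y : ℕ^ (suc r)} → head x ≤ head y → tail x ≤ᵛ tail y → x ≤ᵛ y
≤ᵛ-cons head≤ tail≤ zero    = head≤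
≤ᵛ-cons head≤ tail≤ (suc i) = tail≤ i

-- Bases are taken along an arbitrary map f so that the induction on r can
-- pass to tails without choosing preimages.
Basis : ∀ {A : Set} {r} → (A → ℕ^ r) → (A → Set) → Set
Basis {A} f S = Σ[ B ∈ List (Σ A S) ] (∀ {y} → S y → Any (λ b → f (proj₁ b) ≤ᵛ f y) B)

dickson : ExcludedMiddle 0ℓ → ∀ {A : Set} r (f : A → ℕ^ r) (S : A → Set) → Basis f S
dickson lem zero f S with lem {∃ S}
... | yes (x , Sx) = [ x , Sx ] , λ _ → here λ ()
... | no ∄S        = [] , λ Sy → ⊥-elim (∄S (_ , Sy))
dickson lem {A} (suc r) f S = B₁ ++ concatMap slice (upTo bound) , cover
  where
  B₁ : List (Σ A S)
  B₁ = proj₁ (dickson lem r (tail ∘ f) S)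

  bound : ℕ
  bound = max 0 (map (head ∘ f ∘ proj₁) B₁)

  Slice : ℕ → A → Set
  Slice c x = S x × head (f x) ≡ c

  slice : ℕ → List (Σ A S)
  slice c = map (Σ.map₂ proj₁) (proj₁ (dickson lem r (tail ∘ f) (Slice c)))

  slice-cover : ∀ {y} → S y → Any (λ b → f (proj₁ b) ≤ᵛ f y) (slice (head (f y)))
  slice-cover {y} Sy =
    map⁺ (Any.map (λ {b} → lift {b}) (proj₂ (dickson lem r (tail ∘ f) (Slice (head (f y)))) (Sy , refl)))
    where
    lift : ∀ {b : Σ A (Slice (head (f y)))} → tail (f (proj₁ b)) ≤ᵛ tail (f y) → f (proj₁ b) ≤ᵛ f y
    lift {_ , _ , same-head} = ≤ᵛ-cons (≤-reflexive same-head)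

  cover : ∀ {y} → S y → Any (λ b → f (proj₁ b) ≤ᵛ f y) (B₁ ++ concatMap slice (upTo bound))
  cover {y} Sy with find (proj₂ (dickson lem r (tail ∘ f) S) Sy)
  ... | b , b∈B₁ , tail≤ with head (f (proj₁ b)) ≤? head (f y)
  ...   | yes head≤ = ++⁺ˡ (lose b∈B₁ (≤ᵛ-cons head≤ tail≤))
  ...   | no  head≰ = ++⁺ʳ B₁ (concatMap⁺ slice (lose (∈-upTo⁺ y<bound) (slice-cover Sy)))
    where
    y<bound : head (f y) < bound
    y<bound = <-≤-trans (≰⇒> head≰) (v≤max⁺ 0 _ (inj₂ (map⁺ (lose b∈B₁ ≤-refl))))

least-witness : ExcludedMiddle 0ℓ → (P : ℕ → Set) →
                ∀ {n} → P n → Σ[ m ∈ ℕ ] P m × (∀ {k} → k < m → ¬ P k)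
least-witness lem P {n} = <-rec Least step n
  where
  Least : ℕ → Set
  Least n = P n → Σ[ m ∈ ℕ ] P m × (∀ {k} → k < m → ¬ P k)

  step : ∀ n → (∀ {k} → k < n → Least k) → Least n
  step n below Pn with lem {∃ λ k → k < n × P k}
  ... | yes (k , k<n , Pk) = below k<n Pk
  ... | no none-below      = n , Pn , λ k<n Pk → none-below (_ , k<n , Pk)

module Subgroups where
  open import Data.Integer using (ℤ; +_; -[1+_]; _+_; _*_; -_; _-_)
  open import Data.Integer.DivMod using (_/ℕ_; _%ℕ_; a≡a%ℕn+[a/ℕn]*n; n%ℕd<d)
  open import Data.Integer.Properties
    using (*-zeroˡ; *-zeroʳ; +-identityˡ; +-inverseʳ; neg-distribˡ-*; pos-+; pos-*; +-injective; m-n≡m⊖n; ⊖-≥)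
  open import Data.Integer.Tactic.RingSolver using (solve-∀)
  open import Data.Nat as ℕ using (NonZero; s≤s)
  open import Data.Nat.Properties using (m+[n∸m]≡n)
  open import Data.Vec.Functional using (_∷_)
  open import Relation.Binary.PropositionalEquality using (cong₂; module ≡-Reasoning)

  _≡_[mod_·_] : ∀ {r} → ℤ^ r → ℤ^ r → ℕ → (ℤ^ r → Set) → Set
  h ≡ ρ [mod N · H ] = Σ[ k ∈ ℤ^ _ ] H k × (∀ i → h i ≡ ρ i + + N * k i)

  module _ {r} {H : ℤ^ r → Set} (H-subgroup : IsSubgroup H) where
    open IsSubgroup H-subgroup

    sub-mem : ∀ {a b} → H a → H b → H (λ i → a i - b i)
    sub-mem a∈H b∈H = add-mem a∈H (neg-mem b∈H)

    ℕ*-mem : ∀ {g} → H g → ∀ n → H (λ i → + n * g i)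
    ℕ*-mem {g} g∈H zero    = resp (λ i → sym (*-zeroˡ (g i))) zero-mem
    ℕ*-mem {g} g∈H (suc n) = resp (λ i → sym (suc-* (g i))) (add-mem g∈H (ℕ*-mem g∈H n))
      where
      distrib : ∀ x m → (+ 1 + m) * x ≡ x + m * x
      distrib = solve-∀
      suc-* : ∀ x → + suc n * x ≡ x + + n * x
      suc-* x = trans (cong (_* x) (pos-+ 1 n)) (distrib x (+ n))

    *-mem : ∀ {g} → H g → ∀ q → H (λ i → q * g i)
    *-mem     g∈H (+ n)    = ℕ*-mem g∈H n
    *-mem {g} g∈H -[1+ n ] = resp (λ i → neg-distribˡ-* (+ suc n) (g i)) (neg-mem (ℕ*-mem g∈H (suc n)))

    congruent-difference : ∀ {N a b ρ} → a ≡ ρ [mod N · H ] → b ≡ ρ [mod N · H ] →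
                           Σ[ k ∈ ℤ^ r ] H k × (∀ i → a i - b i ≡ + N * k i)
    congruent-difference {N} {a} {b} {ρ} (ka , ka∈H , a≡) (kb , kb∈H , b≡) =
      (λ i → ka i - kb i) , sub-mem ka∈H kb∈H , difference
      where
      open ≡-Reasoning
      cancel : ∀ ρ n x y → (ρ + n * x) - (ρ + n * y) ≡ n * (x - y)
      cancel = solve-∀
      difference : ∀ i → a i - b i ≡ + N * (ka i - kb i)
      difference i = begin
        a i - b i                                ≡⟨ cong₂ _-_ (a≡ i) (b≡ i) ⟩
        (ρ i + + N * ka i) - (ρ i + + N * kb i)  ≡⟨ cancel (ρ i) (+ N) (ka i) (kb i) ⟩
        + N * (ka i - kb i)                      ∎

    ≡mod-shift : ∀ {N g e ρ h} → H g → e ≡ ρ [mod N · H ] → ∀ J Q →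
                 (∀ i → h i ≡ e i + (J + Q * + N) * g i) → h ≡ (λ i → J * g i + ρ i) [mod N · H ]
    ≡mod-shift {N} {g} {e} {ρ} {h} g∈H (k , k∈H , e≡) J Q h≡ =
      (λ i → Q * g i + k i) , add-mem (*-mem g∈H Q) k∈H , shifted
      where
      open ≡-Reasoning
      regroup : ∀ ρ k J Q n g → (ρ + n * k) + (J + Q * n) * g ≡ (J * g + ρ) + n * (Q * g + k)
      regroup = solve-∀
      shifted : ∀ i → h i ≡ (J * g i + ρ i) + + N * (Q * g i + k i)
      shifted i = begin
        h i                                     ≡⟨ h≡ i ⟩
        e i + (J + Q * + N) * g i               ≡⟨ cong (_+ (J + Q * + N) * g i) (e≡ i) ⟩
        (ρ i + + N * k i) + (J + Q * + N) * g i ≡⟨ regroup (ρ i) (k i) J Q (+ N) (g i) ⟩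
        (J * g i + ρ i) + + N * (Q * g i + k i) ∎

    offset-mem : ∀ {γ x} → x ∈ γ +ˢ (λ τ → τ ∈H∩ℕ H) → H (λ i → + x i - + γ i)
    offset-mem {γ} {x} (τ , τ∈H , x≡) = resp τ≡offset τ∈H
      where
      cancel : ∀ a b → b ≡ (a + b) - a
      cancel = solve-∀
      τ≡offset : ∀ i → + τ i ≡ + x i - + γ i
      τ≡offset i = trans (cancel (+ γ i) (+ τ i))
                         (cong (_- + γ i) (sym (trans (cong +_ (x≡ i)) (pos-+ (γ i) (τ i)))))

    dominating-congruent : ∀ {N} {c ρ : ℤ^ r} {x δ : ℕ^ r} →
      (λ i → + x i - c i) ≡ ρ [mod N · H ] → (λ i → + δ i - c i) ≡ ρ [mod N · H ] →
      δ ≤ᵛ x → x ∈ δ +ˢ InNH∩ℕ N H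
    dominating-congruent {N} {c} {ρ} {x} {δ} x≡ρ δ≡ρ δ≤x
      with k , k∈H , difference ← congruent-difference {N} {ρ = ρ} x≡ρ δ≡ρ =
      (λ i → x i ∸ δ i) , (k , k∈H , gap) , λ i → sym (m+[n∸m]≡n (δ≤x i))
      where
      open ≡-Reasoning
      cancel : ∀ x δ c → x - δ ≡ (x - c) - (δ - c)
      cancel = solve-∀
      gap : ∀ i → + (x i ∸ δ i) ≡ + N * k i
      gap i = begin
        + (x i ∸ δ i)                  ≡⟨ sym (trans (m-n≡m⊖n (x i) (δ i)) (⊖-≥ (δ≤x i))) ⟩
        + x i - + δ i                  ≡⟨ cancel (+ x i) (+ δ i) (c i) ⟩
        (+ x i - c i) - (+ δ i - c i)  ≡⟨ difference i ⟩
        + N * k i                      ∎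

  headKernel : ∀ {r} → (ℤ^ (suc r) → Set) → ℤ^ r → Set
  headKernel H v = H (+ 0 ∷ v)

  module _ {r} {H : ℤ^ (suc r) → Set} (H-subgroup : IsSubgroup H) where
    open IsSubgroup H-subgroup

    headKernel-isSubgroup : IsSubgroup (headKernel H)
    headKernel-isSubgroup = record
      { zero-mem = resp (λ { zero → refl ; (suc i) → refl }) zero-mem
      ; add-mem  = λ a∈K b∈K → resp (λ { zero → refl ; (suc i) → refl }) (add-mem a∈K b∈K)
      ; neg-mem  = λ a∈K → resp (λ { zero → refl ; (suc i) → refl }) (neg-mem a∈K)
      ; resp     = λ a≗b → resp (λ { zero → refl ; (suc i) → a≗b i })
      }

    ≡mod-headKernel : ∀ {N e ρ} → head e ≡ + 0 → tail e ≡ ρ [mod N · headKernel H ] →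
                      e ≡ (+ 0 ∷ ρ) [mod N · H ]
    ≡mod-headKernel {N} e₀≡0 (k , k∈K , tail≡) = (+ 0 ∷ k) , k∈K , λ
      { zero    → trans e₀≡0 (sym (trans (+-identityˡ _) (*-zeroʳ (+ N))))
      ; (suc i) → tail≡ i
      }

  module _ (lem : ExcludedMiddle 0ℓ) {r} {H : ℤ^ (suc r) → Set} (H-subgroup : IsSubgroup H) where
    open IsSubgroup H-subgroup

    PositiveHead : ℕ → Set
    PositiveHead n = Σ[ h ∈ ℤ^ (suc r) ] H h × head h ≡ + suc n

    -- g is an element of H with least positive first coordinate, or 0 if there is none.
    head-generator : Σ[ g ∈ ℤ^ (suc r) ] H g × (∀ {h} → H h → Σ[ q ∈ ℤ ] head h ≡ q * head g)
    head-generator with lem {∃ PositiveHead}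
    ... | no ∄positive = (λ _ → + 0) , zero-mem , only-zero
      where
      only-zero : ∀ {h} → H h → Σ[ q ∈ ℤ ] head h ≡ q * + 0
      only-zero {h} h∈H with head h in eq
      ... | + zero   = + 0 , refl
      ... | + suc n  = ⊥-elim (∄positive (n , h , h∈H , eq))
      ... | -[1+ n ] = ⊥-elim (∄positive (n , _ , neg-mem h∈H , cong -_ eq))
    ... | yes (_ , positive) with least-witness lem PositiveHead positive
    ... | m , (g , g∈H , g₀≡) , minimal = g , g∈H , divides
      where
      cancel : ∀ s x → (s + x) - x ≡ s
      cancel = solve-∀
      divides : ∀ {h} → H h → Σ[ q ∈ ℤ ] head h ≡ q * head g
      divides {h} h∈H with head h %ℕ suc m | n%ℕd<d (head h) (suc m) | a≡a%ℕn+[a/ℕn]*n (head h) (suc m)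
      ... | zero  | _       | h₀≡ = q , trans h₀≡ (trans (+-identityˡ _) (cong (q *_) (sym g₀≡)))
        where q = head h /ℕ suc m
      ... | suc t | s≤s t<m | h₀≡ =
        ⊥-elim (minimal t<m (_ , sub-mem H-subgroup h∈H (*-mem H-subgroup g∈H q) , remainder))
        where
        open ≡-Reasoning
        q = head h /ℕ suc m
        remainder : head h - q * head g ≡ + suc t
        remainder = begin
          head h - q * head g                    ≡⟨ cong₂ (λ a b → a - q * b) h₀≡ g₀≡ ⟩
          (+ suc t + q * + suc m) - q * + suc m  ≡⟨ cancel (+ suc t) (q * + suc m) ⟩
          + suc t                                ∎

  finite-index : ExcludedMiddle 0ℓ → ∀ r {H : ℤ^ r → Set} → IsSubgroup H →
                 ∀ N .{{_ : NonZero N}} →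
                 Σ[ R ∈ List (ℤ^ r) ] (∀ {h} → H h → Any (λ ρ → h ≡ ρ [mod N · H ]) R)
  finite-index lem zero H-subgroup N = [ (λ ()) ] , λ _ → here ((λ _ → + 0) , zero-mem , λ ())
    where open IsSubgroup H-subgroup
  finite-index lem (suc r) {H} H-subgroup N
    with g , g∈H , divides ← head-generator lem H-subgroup
       | RK , RK-cover ← finite-index lem r (headKernel-isSubgroup H-subgroup) N =
    concatMap translates (upTo N) , cover
    where
    open IsSubgroup H-subgroup

    translates : ℕ → List (ℤ^ (suc r))
    translates J = map (λ ρ i → + J * g i + (+ 0 ∷ ρ) i) RK

    cover : ∀ {h} → H h → Any (λ ρ → h ≡ ρ [mod N · H ]) (concatMap translates (upTo N))
    cover {h} h∈H with q , h₀≡ ← divides h∈H =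
      concatMap⁺ translates (lose (∈-upTo⁺ (n%ℕd<d q N)) (map⁺ (Any.map shift (RK-cover tail-e∈K))))
      where
      open ≡-Reasoning
      e : ℤ^ (suc r)
      e i = h i - q * g i
      e₀≡0 : head e ≡ + 0
      e₀≡0 = trans (cong (_- q * head g) h₀≡) (+-inverseʳ (q * head g))
      tail-e∈K : headKernel H (tail e)
      tail-e∈K = resp (λ { zero → e₀≡0 ; (suc i) → refl })
                      (sub-mem H-subgroup h∈H (*-mem H-subgroup g∈H q))
      restore : ∀ h x → h ≡ (h - x) + x
      restore = solve-∀
      h≡ : ∀ i → h i ≡ e i + (+ (q %ℕ N) + (q /ℕ N) * + N) * g i
      h≡ i = begin
        h i                                        ≡⟨ restore (h i) (q * g i) ⟩
        e i + q * g i                              ≡⟨ cong (λ q → e i + q * g i) (a≡a%ℕn+[a/ℕn]*n q N) ⟩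
        e i + (+ (q %ℕ N) + (q /ℕ N) * + N) * g i  ∎
      shift : ∀ {ρ} → tail e ≡ ρ [mod N · headKernel H ] →
              h ≡ (λ i → + (q %ℕ N) * g i + (+ 0 ∷ ρ) i) [mod N · H ]
      shift tail≡ρ = ≡mod-shift H-subgroup {N} {e = e} g∈H
                       (≡mod-headKernel H-subgroup {N} {e} e₀≡0 tail≡ρ) (+ (q %ℕ N)) (q /ℕ N) h≡

  natural-factor : ∀ {N t} → 0 < N → ∀ k → + t ≡ + N * k → Σ[ n ∈ ℕ ] k ≡ + n
  natural-factor             _ (+ n)    _  = n , refl
  natural-factor {N = suc _} _ -[1+ _ ] ()

  N·H∩ℕ⊆N·[H∩ℕ] : ∀ {r N} {H : ℤ^ r → Set} → IsSubgroup H → 0 < N →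
                  ∀ {t} → InNH∩ℕ N H t → Σ[ τ ∈ ℕ^ r ] τ ∈H∩ℕ H × (∀ i → t i ≡ N ℕ.* τ i)
  N·H∩ℕ⊆N·[H∩ℕ] {N = N} H-subgroup N>0 (k , k∈H , t≡) =
    τ , IsSubgroup.resp H-subgroup k≡τ k∈H ,
    λ i → +-injective (trans (t≡ i) (trans (cong (+ N *_) (k≡τ i)) (sym (pos-* N (τ i)))))
    where
    τ : ℕ^ _
    τ i = proj₁ (natural-factor N>0 (k i) (t≡ i))
    k≡τ : ∀ i → k i ≡ + τ i
    k≡τ i = proj₂ (natural-factor N>0 (k i) (t≡ i))

open Subgroups
open import Data.Nat using (_+_; _*_)

coset-⊆ : ∀ {r N} {H : ℤ^ r → Set} {L : ℕ^ r → Set} → IsSubgroup H → 0 < N →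
          (∀ {x y} → (∀ i → x i ≡ y i) → L x → L y) →
          (∀ τ β → τ ∈H∩ℕ H → L β → L (λ i → β i + N * τ i)) →
          ∀ {δ x} → L δ → x ∈ δ +ˢ InNH∩ℕ N H → L x
coset-⊆ H-subgroup N>0 L-resp L-closed Lδ (t , t∈N·H , x≡)
  with τ , τ∈H , t≡ ← N·H∩ℕ⊆N·[H∩ℕ] H-subgroup N>0 t∈N·H =
  L-resp (λ i → sym (trans (x≡ i) (cong (_ +_) (t≡ i)))) (L-closed τ _ τ∈H Lδ)

open import Data.Integer using (+_; _-_)

proposition2p7 : ExcludedMiddle 0ℓ →
    (r : ℕ) (γ : ℕ^ r) (H : ℤ^ r → Set) → IsSubgroup H →
    (N : ℕ) → 0 < N →
    (L : ℕ^ r → Set) →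
    (∀ {x y} → (∀ i → x i ≡ y i) → L x → L y) →
    (∀ β → L β → β ∈ γ +ˢ (λ τ → τ ∈H∩ℕ H)) →
    (∀ τ β → τ ∈H∩ℕ H → L β → L (λ i → β i + N * τ i)) →
    Σ (List (ℕ^ r)) λ δs →
      ∀ x → L x ⇔ Any (λ δ → x ∈ δ +ˢ InNH∩ℕ N H) δs
proposition2p7 lem r γ H H-subgroup N N>0 L L-resp L⊆γ+H L-closed
  with R , R-cover ← finite-index lem r H-subgroup N {{>-nonZero N>0}} =
  concatMap minimal R , λ x → mk⇔ (covered x) (in-L x)
  where
  InClass : ℤ^ r → ℕ^ r → Set
  InClass ρ x = L x × (λ i → + x i - + γ i) ≡ ρ [mod N · H ]

  basis : ∀ ρ → Basis id (InClass ρ)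
  basis ρ = dickson lem r id (InClass ρ)

  minimal : ℤ^ r → List (ℕ^ r)
  minimal ρ = map proj₁ (proj₁ (basis ρ))

  covered : ∀ x → L x → Any (λ δ → x ∈ δ +ˢ InNH∩ℕ N H) (concatMap minimal R)
  covered x Lx =
    concatMap⁺ minimal {xs = R} (Any.map (λ {ρ} → in-class ρ) (R-cover (offset-mem H-subgroup (L⊆γ+H x Lx))))
    where
    in-class : ∀ ρ → (λ i → + x i - + γ i) ≡ ρ [mod N · H ] →
               Any (λ δ → x ∈ δ +ˢ InNH∩ℕ N H) (minimal ρ)
    in-class ρ x≡ρ = map⁺ (Any.map
      (λ { {_ , _ , δ≡ρ} → dominating-congruent H-subgroup {N} {λ i → + γ i} {ρ} x≡ρ δ≡ρ })
      (proj₂ (basis ρ) (Lx , x≡ρ)))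

  in-L : ∀ x → Any (λ δ → x ∈ δ +ˢ InNH∩ℕ N H) (concatMap minimal R) → L x
  in-L x p with _ , p′ ← Any.satisfied (concatMap⁻ minimal {xs = R} p)
           with (_ , Lδ , _) , x∈δ+ ← Any.satisfied (map⁻ p′) =
    coset-⊆ H-subgroup N>0 L-resp L-closed Lδ x∈δ+
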